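{- For all positive integers $r$ and $s$, every permutation of the positive integers contains an $(r,s)$ $3$-progression.
   Context: A permutation of the positive integers is a sequence $p_1,p_2,\dots$ in which every positive integer appears exactly once. For positive integers $r_1,\dots,r_{k-1}$, an $(r_1,\dots,r_{k-1})$ $k$-progression is a sequence $a, a+r_1d, a+(r_1+r_2)d,\dots,a+\left(\sum_{i=1}^{k-1}r_i\right)d$ with $a,d$ integers and $d\neq 0$. A permutation contains such a progression if there are indices $i_1<\dots<i_k$ such that $p_{i_1},\dots,p_{i_k}$ is one. In particular, an $(r,s)$ $3$-progression is $a, a+rd, a+rd+sd$ with $d\neq0$. -}

module Defs where

open import Data.Nat using (ℕ; suc; _<_)
open import Data.Integer using (ℤ; +_; _+_; _*_; 0ℤ)
open import Data.Product using (∃; ∃-syntax; _×_; _,_)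
open import Function.Bundles using (Bijection)
open import Relation.Binary.PropositionalEquality using (_≡_; _≢_; setoid)

-- A permutation of the positive integers p₁, p₂, … is encoded as a bijection
-- π : ℕ → ℕ via  p_{i+1} = π i + 1  (0-based indices, values shifted by 1).
Permutation⁺ : Set
Permutation⁺ = Bijection (setoid ℕ) (setoid ℕ)

value : Permutation⁺ → ℕ → ℤ
value π i = + suc (Bijection.to π i)

IsProgression3 : ℕ → ℕ → ℤ → ℤ → ℤ → Set
IsProgression3 r s x y z =
  ∃[ a ] ∃[ d ] (d ≢ 0ℤ × x ≡ a × y ≡ a + (+ r) * d × z ≡ a + (+ r) * d + (+ s) * d)

Contains3 : ℕ → ℕ → Permutation⁺ → Set
Contains3 r s π = ∃[ i ] ∃[ j ] ∃[ k ]
  (i < j × j < k × IsProgression3 r s (value π i) (value π j) (value π k))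

module Submission where

-- Work with the 0-based form  f : ℕ → ℕ  of the permutation (p_{i+1} = f i + 1)
-- and its inverse g.  Let Q be the largest position among the values 0,…,r-1,
-- M the largest value at positions 0,…,Q, and j the FIRST position with
-- f j > M.  Then j > Q, and f j ≥ r, so write  f j = c + r·d  with c < r and
-- d = f j / r ≥ 1.  Take i = g c (a position ≤ Q < j) and k = g (f j + s·d).
-- Since f k > f j > M while every position before j carries a value ≤ M, we
-- get k > j.  The values at i, j, k are c, c + r d, c + r d + s d, an
-- (r,s) progression with common difference d ≠ 0, and shifting by 1 keeps it so.

open import Defs
open import Data.Nat using (ℕ; NonZero; zero; suc; _+_; _*_; _≤_; _<_; _⊔_; z≤n; s≤s; s≤s⁻¹; _<?_)
open import Data.Nat.Properties
open import Data.Nat.DivMod using (_/_; _%_; m≡m%n+[m/n]*n; m%n<n; m≥n⇒m/n>0)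
open import Data.Nat.Induction using (<-rec)
open import Data.Integer as ℤ using (+_)
open import Data.Integer.Properties using (pos-+; pos-*; +-injective)
open import Data.Product using (∃-syntax; _×_; _,_; proj₁; proj₂)
open import Data.Sum using (inj₁; inj₂)
open import Function.Bundles using (Bijection)
open import Relation.Nullary using (¬_; yes; no; contradiction)
open import Relation.Unary using (Pred; Decidable)
open import Relation.Binary.PropositionalEquality
open import Relation.Binary using (tri<; tri≈; tri>)

maxUpTo : (ℕ → ℕ) → ℕ → ℕ
maxUpTo f zero    = f zero
maxUpTo f (suc n) = maxUpTo f n ⊔ f (suc n)

maxUpTo-upper : ∀ f n {i} → i ≤ n → f i ≤ maxUpTo f n
maxUpTo-upper f zero    z≤n = ≤-refl
maxUpTo-upper f (suc n) i≤1+n with m≤n⇒m<n∨m≡n i≤1+n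
... | inj₁ (s≤s i≤n) = ≤-trans (maxUpTo-upper f n i≤n) (m≤m⊔n _ _)
... | inj₂ refl      = m≤n⊔m _ _

least : ∀ {p} {P : Pred ℕ p} → Decidable P →
        ∀ n → P n → ∃[ j ] (P j × ∀ i → i < j → ¬ P i)
least {P = P} P? = <-rec (λ n → P n → ∃[ j ] (P j × ∀ i → i < j → ¬ P i)) step
  where
  step : ∀ n → (∀ {m} → m < n → P m → ∃[ j ] (P j × ∀ i → i < j → ¬ P i)) →
         P n → ∃[ j ] (P j × ∀ i → i < j → ¬ P i)
  step n rec Pn with anyUpTo? P? n
  ... | yes (m , m<n , Pm) = rec m<n Pm
  ... | no  none           = n , Pn , λ i i<n Pi → none (i , i<n , Pi)

firstAbove : (f : ℕ → ℕ) (M n : ℕ) → M < f n →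
             ∃[ j ] (M < f j × ∀ i → i < j → f i ≤ M)
firstAbove f M n M<fn with least (λ i → M <? f i) n M<fn
... | j , M<fj , before = j , M<fj , λ i i<j → ≮⇒≥ (before i i<j)

afterFirstAbove : ∀ (f : ℕ → ℕ) {M j k} → (∀ i → i < j → f i ≤ M) →
                  M < f j → f j < f k → j < k
afterFirstAbove f {j = j} {k} before M<fj fj<fk with <-cmp j k
... | tri< j<k _ _ = j<k
... | tri≈ _ refl _ = contradiction fj<fk (<-irrefl refl)
... | tri> _ _ k<j = contradiction (before k k<j) (<⇒≱ (<-trans M<fj fj<fk))

shiftedProgression : ∀ r s c d {x y z} → 0 < d →
  x ≡ c → y ≡ c + r * d → z ≡ c + r * d + s * d →
  IsProgression3 r s (+ suc x) (+ suc y) (+ suc z)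
shiftedProgression r s c d d>0 refl refl refl = + suc c , + d , d≢0 , refl , middle , last
  where
  d≢0 : + d ≢ ℤ.0ℤ
  d≢0 eq = >⇒≢ d>0 (+-injective eq)
  middle : + suc (c + r * d) ≡ + suc c ℤ.+ + r ℤ.* + d
  middle = trans (pos-+ (suc c) (r * d)) (cong (ℤ._+_ (+ suc c)) (pos-* r d))
  last : + suc (c + r * d + s * d) ≡ + suc c ℤ.+ + r ℤ.* + d ℤ.+ + s ℤ.* + d
  last = trans (pos-+ (suc (c + r * d)) (s * d)) (cong₂ ℤ._+_ middle (pos-* s d))

module _ (π : Permutation⁺) where

  private
    f : ℕ → ℕ
    f = Bijection.to π

    g : ℕ → ℕ
    g v = proj₁ (Bijection.surjective π v)

    f∘g : ∀ v → f (g v) ≡ v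
    f∘g v = proj₂ (Bijection.surjective π v) refl

  lastPosition : ℕ → ℕ
  lastPosition = maxUpTo g

  valueBound : ℕ → ℕ
  valueBound n = maxUpTo f (lastPosition n)

  bound-≥ : ∀ n → n ≤ valueBound n
  bound-≥ n = subst (_≤ valueBound n) (f∘g n)
    (maxUpTo-upper f (lastPosition n) (maxUpTo-upper g n ≤-refl))

  exceeds : ∀ n → ∃[ j ] (valueBound n < f j)
  exceeds n = g (suc (valueBound n)) , subst (valueBound n <_) (sym (f∘g _)) ≤-refl

  progressionAtFirstAbove : ∀ r-1 s-1 {j} → let M = valueBound r-1 in
    M < f j → (∀ i → i < j → f i ≤ M) → Contains3 (suc r-1) (suc s-1) π
  progressionAtFirstAbove r-1 s-1 {j} M<fj before =
    i , j , k , i<j , j<k , shiftedProgression r s c d d>0 (f∘g c) fj≡c+rd fk≡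
    where
    r = suc r-1
    s = suc s-1
    c = f j % r
    d = f j / r
    i = g c
    k = g (f j + s * d)

    fj≡c+rd : f j ≡ c + r * d
    fj≡c+rd = trans (m≡m%n+[m/n]*n (f j) r) (cong (_+_ c) (*-comm d r))

    fk≡ : f k ≡ c + r * d + s * d
    fk≡ = trans (f∘g _) (cong (λ v → v + s * d) fj≡c+rd)

    d>0 : 0 < d
    d>0 = m≥n⇒m/n>0 (≤-<-trans (bound-≥ r-1) M<fj)

    -- j lies beyond every position ≤ Q(r-1), since those carry values ≤ M
    Q<j : lastPosition r-1 < j
    Q<j = ≰⇒> λ j≤Q → <⇒≱ M<fj (maxUpTo-upper f (lastPosition r-1) j≤Q)

    i<j : i < j
    i<j = ≤-<-trans (maxUpTo-upper g r-1 (s≤s⁻¹ (m%n<n (f j) r))) Q<j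

    sd>0 : 0 < s * d
    sd>0 = <-≤-trans d>0 (m≤m+n d (s-1 * d))

    -- f k = f j + s d exceeds f j, so k comes after the first exceedance j
    j<k : j < k
    j<k = afterFirstAbove f before M<fj (subst (f j <_) (sym (f∘g _)) (m<m+n (f j) sd>0))

mainTheorem6 : (r s : ℕ) → NonZero r → NonZero s → (π : Permutation⁺) → Contains3 r s π
mainTheorem6 (suc r-1) (suc s-1) _ _ π =
  let (n , M<fn) = exceeds π r-1
      (j , M<fj , before) = firstAbove (Bijection.to π) (valueBound π r-1) n M<fn
  in progressionAtFirstAbove π r-1 s-1 M<fj before
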